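{- Let $G=(V,E_G)$ be the rectangular grid graph with $m$ rows and $n$ columns, i.e. vertices $(i,j)$ with $1\le i\le n$, $1\le j\le m$, adjacent iff they differ by $1$ in exactly one coordinate. Let $E,F\in V$ with $d_G(E,F)\ge 2$, and let $G'=(V,E_G\cup\{EF\})$. Then the set of the four corners $\{(1,1),(n,1),(n,m),(1,m)\}$ is a resolving set of $G'$; consequently $\beta(G')\le 4$.
   Context: For a connected graph $H$, a set $R$ of vertices is resolving if every pair of distinct vertices $A\ne B$ has some $X\in R$ with $d_H(A,X)\ne d_H(B,X)$, where $d_H$ is shortest-path distance; the metric dimension $\beta(H)$ is the minimum size of a resolving set. -}

module Defs where

open import Data.Nat using (ℕ; zero; suc; _≤_)
open import Data.Fin using (Fin; toℕ; fromℕ)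
import Data.Fin as F
open import Data.Product using (_×_; _,_; Σ; ∃; ∃-syntax)
open import Data.Sum using (_⊎_)
open import Data.List using (List; length; _∷_; [])
open import Data.List.Membership.Propositional using (_∈_)
open import Relation.Binary.PropositionalEquality using (_≡_; _≢_)

data Walk {V : Set} (adj : V → V → Set) : V → V → ℕ → Set where
  here : ∀ {x} → Walk adj x x 0
  step : ∀ {x y z k} → adj x y → Walk adj y z k → Walk adj x z (suc k)

IsDist : {V : Set} → (V → V → Set) → V → V → ℕ → Set
IsDist adj x y k = Walk adj x y k × (∀ l → Walk adj x y l → k ≤ l)

Resolving : {V : Set} → (V → V → Set) → List V → Set
Resolving {V} adj R =
  ∀ (A B : V) → A ≢ B →
    ∃[ X ] (X ∈ R × ∃[ k ] ∃[ l ] (IsDist adj A X k × IsDist adj B X l × k ≢ l))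

MetricDimLe : {V : Set} → (V → V → Set) → ℕ → Set
MetricDimLe {V} adj b = ∃[ R ] (length {A = V} R ≤ b × Resolving adj R)

-- Grid graph with n columns and m rows (vertices (i,j), i a column index,
-- j a row index, both 0-based: i : Fin n, j : Fin m).
Vtx : ℕ → ℕ → Set
Vtx n m = Fin n × Fin m

Adj1 : ∀ {k} → Fin k → Fin k → Set
Adj1 a b = (toℕ b ≡ suc (toℕ a)) ⊎ (toℕ a ≡ suc (toℕ b))

GridAdj : (n m : ℕ) → Vtx n m → Vtx n m → Set
GridAdj n m (i , j) (i' , j') = (i ≡ i' × Adj1 j j') ⊎ (j ≡ j' × Adj1 i i')

AddEdge : {V : Set} → (V → V → Set) → V → V → V → V → Set
AddEdge adj E F x y = adj x y ⊎ ((x ≡ E × y ≡ F) ⊎ (x ≡ F × y ≡ E))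

-- The four corners of the grid with n = suc n' columns and m = suc m' rows:
-- (1,1), (n,1), (n,m), (1,m) in 1-based coordinates.
corners : (n' m' : ℕ) → List (Vtx (suc n') (suc m'))
corners n' m' =
  (F.zero , F.zero) ∷ (fromℕ n' , F.zero) ∷ (fromℕ n' , fromℕ m') ∷ (F.zero , fromℕ m') ∷ []

-- In the grid, d is the Manhattan distance; after adding the edge EF the
-- distance d⁺(X,Y) is the least of d(X,Y), d(X,E) + 1 + d(F,Y) and
-- d(X,F) + 1 + d(E,Y).  Given A ≠ B, let c be the corner lying beyond B as seen
-- from A in both coordinates and c' the opposite corner: B lies on a geodesic
-- from A to c, A on one from B to c', and d(X,c) + d(X,c') = n' + m' for all X.
-- If neither corner separated A from B, then d⁺(A,c) ≤ d(B,c) < d(A,c) and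
-- d⁺(B,c') ≤ d(A,c') < d(B,c') force both distances through the new edge, and the
-- two detours add up to more than n' + m' = d(A,c) + d(A,c').
module Submission where

open import Defs
open import Data.Nat using (ℕ; zero; suc; _≤_; _<_; _+_; _⊓_; ∣_-_∣; z≤n; s≤s)
open import Data.Nat.Properties
open import Algebra.Properties.CommutativeSemigroup +-commutativeSemigroup using (interchange)
open import Data.Nat.Tactic.RingSolver using (solve-∀)
open import Data.Fin using (Fin; toℕ; fromℕ)
import Data.Fin as F
open import Data.Fin.Properties using (toℕ-injective; toℕ≤pred[n]; toℕ-fromℕ)
open import Data.Product using (_×_; _,_; proj₁; proj₂; ∃-syntax)
open import Data.Sum using (_⊎_; inj₁; inj₂)
import Data.Sum as Sum
open import Data.Empty using (⊥)
open import Function using (_∘_)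
open import Data.List.Membership.Propositional using (_∈_)
open import Data.List.Relation.Unary.Any using (here; there)
open import Relation.Binary.PropositionalEquality
open import Relation.Nullary using (yes; no; contradiction)

Lipschitz : {V : Set} → (V → V → Set) → (V → ℕ) → Set
Lipschitz adj φ = ∀ {x x'} → adj x x' → φ x ≤ suc (φ x')

module _ {V : Set} {adj : V → V → Set} where

  mapʷ : {W : Set} {adj' : W → W → Set} (f : V → W) → (∀ {x y} → adj x y → adj' (f x) (f y)) →
    ∀ {x y k} → Walk adj x y k → Walk adj' (f x) (f y) k
  mapʷ f f-adj here = here
  mapʷ f f-adj (step a w) = step (f-adj a) (mapʷ f f-adj w)

  _++ʷ_ : ∀ {x y z k l} → Walk adj x y k → Walk adj y z l → Walk adj x z (k + l)
  here ++ʷ w' = w'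
  step a w ++ʷ w' = step a (w ++ʷ w')

  _∷ʳ_ : ∀ {x y z k} → Walk adj x y k → adj y z → Walk adj x z (suc k)
  here ∷ʳ a = step a here
  step b w ∷ʳ a = step b (w ∷ʳ a)

  walk-length-≥ : ∀ {φ} → Lipschitz adj φ → ∀ {x y l} → Walk adj x y l → φ x ≤ l + φ y
  walk-length-≥ lip here = ≤-refl
  walk-length-≥ lip (step a w) = ≤-trans (lip a) (s≤s (walk-length-≥ lip w))

  isDist-by-potential : ∀ {φ x y} → Lipschitz adj φ → φ y ≡ 0 → Walk adj x y (φ x) → IsDist adj x y (φ x)
  isDist-by-potential lip φy≡0 w = w , λ l w' →
    ≤-trans (walk-length-≥ lip w') (≤-reflexive (trans (cong (l +_) φy≡0) (+-identityʳ l)))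

≤-+-suc : ∀ {a b k} → a ≤ b → a ≤ suc (k + b)
≤-+-suc {k = k} a≤b = ≤-trans a≤b (≤-trans (m≤n+m _ k) (n≤1+n _))

module AddedEdge {V : Set} {adj : V → V → Set} (d : V → V → ℕ)
  (d-walk : ∀ x y → Walk adj x y (d x y))
  (d-lipschitz : ∀ y → Lipschitz adj (λ x → d x y))
  (d-self : ∀ x → d x x ≡ 0)
  (E F : V) where

  G⁺ : V → V → Set
  G⁺ = AddEdge adj E F

  d⁺ : V → V → ℕ
  d⁺ x y = d x y ⊓ ((d x E + suc (d F y)) ⊓ (d x F + suc (d E y)))

  d-triangle : ∀ x y z → d x z ≤ d x y + d y z
  d-triangle x y z = walk-length-≥ (d-lipschitz z) (d-walk x y)

  d⁺≤d : ∀ x y → d⁺ x y ≤ d x y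
  d⁺≤d x y = m⊓n≤m _ _

  d⁺≤viaEF : ∀ x y → d⁺ x y ≤ d x E + suc (d F y)
  d⁺≤viaEF x y = ≤-trans (m⊓n≤n _ _) (m⊓n≤m _ _)

  d⁺≤viaFE : ∀ x y → d⁺ x y ≤ d x F + suc (d E y)
  d⁺≤viaFE x y = ≤-trans (m⊓n≤n _ _) (m⊓n≤n _ _)

  d⁺-self : ∀ y → d⁺ y y ≡ 0
  d⁺-self y = n≤0⇒n≡0 (≤-trans (d⁺≤d y y) (≤-reflexive (d-self y)))

  lift : ∀ {x y k} → Walk adj x y k → Walk G⁺ x y k
  lift = mapʷ (λ x → x) inj₁

  d⁺-walk : ∀ x y → Walk G⁺ x y (d⁺ x y)
  d⁺-walk x y with ⊓-sel (d x y) ((d x E + suc (d F y)) ⊓ (d x F + suc (d E y)))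
  ... | inj₁ eq = subst (Walk G⁺ x y) (sym eq) (lift (d-walk x y))
  ... | inj₂ eq with ⊓-sel (d x E + suc (d F y)) (d x F + suc (d E y))
  ...   | inj₁ eq' = subst (Walk G⁺ x y) (sym (trans eq eq'))
            (lift (d-walk x E) ++ʷ step (inj₂ (inj₁ (refl , refl))) (lift (d-walk F y)))
  ...   | inj₂ eq' = subst (Walk G⁺ x y) (sym (trans eq eq'))
            (lift (d-walk x F) ++ʷ step (inj₂ (inj₂ (refl , refl))) (lift (d-walk E y)))

  d⁺-lipschitz : ∀ y → Lipschitz G⁺ (λ x → d⁺ x y)
  d⁺-lipschitz y (inj₁ a) =
    ⊓-mono-≤ (d-lipschitz y a) (⊓-mono-≤ (+-monoˡ-≤ _ (d-lipschitz E a)) (+-monoˡ-≤ _ (d-lipschitz F a)))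
  d⁺-lipschitz y (inj₂ (inj₁ (refl , refl))) =
    ⊓-glb cross (⊓-glb (≤-+-suc cross) (≤-+-suc (≤-trans (d⁺≤d E y) (n≤1+n _))))
    where
    cross : d⁺ E y ≤ suc (d F y)
    cross = subst (λ t → d⁺ E y ≤ t + suc (d F y)) (d-self E) (d⁺≤viaEF E y)
  d⁺-lipschitz y (inj₂ (inj₂ (refl , refl))) =
    ⊓-glb cross (⊓-glb (≤-+-suc (≤-trans (d⁺≤d F y) (n≤1+n _))) (≤-+-suc cross))
    where
    cross : d⁺ F y ≤ suc (d E y)
    cross = subst (λ t → d⁺ F y ≤ t + suc (d E y)) (d-self F) (d⁺≤viaFE F y)

  d⁺-isDist : ∀ x y → IsDist G⁺ x y (d⁺ x y)
  d⁺-isDist x y = isDist-by-potential (d⁺-lipschitz y) (d⁺-self y) (d⁺-walk x y)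

  uses-edge : ∀ {x y z} → d⁺ x y ≤ z → z < d x y → d x E + suc (d F y) ≤ z ⊎ d x F + suc (d E y) ≤ z
  uses-edge {x} {y} le lt with ⊓-sel (d x y) ((d x E + suc (d F y)) ⊓ (d x F + suc (d E y)))
  ... | inj₁ eq = contradiction (subst (_≤ _) eq le) (<⇒≱ lt)
  ... | inj₂ eq with ⊓-sel (d x E + suc (d F y)) (d x F + suc (d E y))
  ...   | inj₁ eq' = inj₁ (subst (_≤ _) (trans eq eq') le)
  ...   | inj₂ eq' = inj₂ (subst (_≤ _) (trans eq eq') le)

  module _ (d-sym : ∀ x y → d x y ≡ d y x) {A B c c' : V} {S : ℕ}
    (0<dAB : 0 < d A B)
    (c-beyond-B : d A c ≡ d A B + d B c)
    (c'-beyond-A : d B c' ≡ d B A + d A c')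
    (antipodal : ∀ X → d X c + d X c' ≡ S) where

    B-closer-to-c : d B c < d A c
    B-closer-to-c = subst (d B c <_) (sym c-beyond-B) (m<n+m (d B c) 0<dAB)

    A-closer-to-c' : d A c' < d B c'
    A-closer-to-c' = subst (d A c' <_) (sym c'-beyond-A) (m<n+m (d A c') (subst (0 <_) (d-sym A B) 0<dAB))

    parallel-detours : ∀ P P' Q → d A P + suc (d Q c) ≤ d B c → d B P' + suc (d Q c') ≤ d A c' → ⊥
    parallel-detours P P' Q detour detour' = <-irrefl refl (begin-strict
      S                             ≡⟨ antipodal Q ⟨
      d Q c + d Q c'                <⟨ +-mono-< (n<1+n _) (n<1+n _) ⟩
      suc (d Q c) + suc (d Q c')    ≤⟨ +-mono-≤ (≤-trans (m≤n+m _ (d A P)) detour) (≤-trans (m≤n+m _ (d B P')) detour') ⟩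
      d B c + d A c'                ≤⟨ +-monoˡ-≤ _ (<⇒≤ B-closer-to-c) ⟩
      d A c + d A c'                ≡⟨ antipodal A ⟩
      S                             ∎)
      where open ≤-Reasoning

    crossed-detours : ∀ P Q → d A P + suc (d Q c) ≤ d B c → d B Q + suc (d P c') ≤ d A c' → ⊥
    crossed-detours P Q detour detour' = <-irrefl refl (begin-strict
      S                                             ≡⟨ antipodal P ⟨
      d P c + d P c'                                ≤⟨ +-monoˡ-≤ _ P-to-c ⟩
      d A P + d A B + d B Q + d Q c + d P c'        <⟨ m<n⇒m<1+n (n<1+n _) ⟩
      suc (suc (d A P + d A B + d B Q + d Q c + d P c'))
        ≡⟨ regroup (d A P) (d A B) (d B Q) (d Q c) (d P c') ⟩
      d A B + ((d A P + suc (d Q c)) + (d B Q + suc (d P c')))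
        ≤⟨ +-monoʳ-≤ (d A B) (+-mono-≤ detour detour') ⟩
      d A B + (d B c + d A c')                      ≡⟨ +-assoc (d A B) (d B c) (d A c') ⟨
      d A B + d B c + d A c'                        ≡⟨ cong (_+ d A c') c-beyond-B ⟨
      d A c + d A c'                                ≡⟨ antipodal A ⟩
      S                                             ∎)
      where
      open ≤-Reasoning
      regroup : ∀ a k b q p → suc (suc (a + k + b + q + p)) ≡ k + ((a + suc q) + (b + suc p))
      regroup = solve-∀
      P-to-c : d P c ≤ d A P + d A B + d B Q + d Q c
      P-to-c = begin
        d P c                        ≤⟨ d-triangle P Q c ⟩
        d P Q + d Q c                ≤⟨ +-monoˡ-≤ _ (d-triangle P A Q) ⟩
        d P A + d A Q + d Q c        ≤⟨ +-monoˡ-≤ _ (+-mono-≤ (≤-reflexive (d-sym P A)) (d-triangle A B Q)) ⟩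
        d A P + (d A B + d B Q) + d Q c  ≡⟨ cong (_+ d Q c) (+-assoc (d A P) (d A B) (d B Q)) ⟨
        d A P + d A B + d B Q + d Q c ∎

    opposite-corners-resolve : d⁺ A c ≢ d⁺ B c ⊎ d⁺ A c' ≢ d⁺ B c'
    opposite-corners-resolve with d⁺ A c ≟ d⁺ B c
    ... | no ne = inj₁ ne
    ... | yes same = inj₂ λ same' →
      detours (uses-edge (subst (_≤ d B c) (sym same) (d⁺≤d B c)) B-closer-to-c)
              (uses-edge (subst (_≤ d A c') same' (d⁺≤d A c')) A-closer-to-c')
      where
      detours : d A E + suc (d F c) ≤ d B c ⊎ d A F + suc (d E c) ≤ d B c →
                d B E + suc (d F c') ≤ d A c' ⊎ d B F + suc (d E c') ≤ d A c' → ⊥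
      detours (inj₁ viaEF) (inj₁ viaEF') = parallel-detours E E F viaEF viaEF'
      detours (inj₂ viaFE) (inj₂ viaFE') = parallel-detours F F E viaFE viaFE'
      detours (inj₁ viaEF) (inj₂ viaFE') = crossed-detours E F viaEF viaFE'
      detours (inj₂ viaFE) (inj₁ viaEF') = crossed-detours F E viaFE viaEF'

dist : ∀ {n} → Fin n → Fin n → ℕ
dist i j = ∣ toℕ i - toℕ j ∣

shift : ∀ {n} {i j : Fin n} {k} → Walk Adj1 i j k → Walk Adj1 (F.suc i) (F.suc j) k
shift = mapʷ F.suc (Sum.map (cong suc) (cong suc))

line-walk : ∀ {n} (i j : Fin n) → Walk Adj1 i j (dist i j)
line-walk F.zero F.zero = here
line-walk F.zero (F.suc F.zero) = step (inj₁ refl) here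
line-walk F.zero (F.suc (F.suc j)) = step (inj₁ refl) (shift (line-walk F.zero (F.suc j)))
line-walk (F.suc F.zero) F.zero = step (inj₂ refl) here
line-walk (F.suc (F.suc i)) F.zero = shift (line-walk (F.suc i) F.zero) ∷ʳ inj₂ refl
line-walk (F.suc i) (F.suc j) = shift (line-walk i j)

∣n-1+n∣≡1 : ∀ n → ∣ n - suc n ∣ ≡ 1
∣n-1+n∣≡1 zero = refl
∣n-1+n∣≡1 (suc n) = ∣n-1+n∣≡1 n

Adj1⇒dist≡1 : ∀ {n} {a b : Fin n} → Adj1 a b → dist a b ≡ 1
Adj1⇒dist≡1 {a = a} (inj₁ eq) rewrite eq = ∣n-1+n∣≡1 (toℕ a)
Adj1⇒dist≡1 {b = b} (inj₂ eq) rewrite eq = trans (∣-∣-comm (suc (toℕ b)) (toℕ b)) (∣n-1+n∣≡1 (toℕ b))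

line-lipschitz : ∀ {n} (y : ℕ) → Lipschitz (Adj1 {n}) (λ x → ∣ toℕ x - y ∣)
line-lipschitz y {a} {b} a~b =
  subst (λ t → ∣ toℕ a - y ∣ ≤ t + ∣ toℕ b - y ∣) (Adj1⇒dist≡1 a~b) (∣-∣-triangle (toℕ a) (toℕ b) y)

module _ {n m : ℕ} where

  manhattan : Vtx n m → Vtx n m → ℕ
  manhattan (i , j) (i' , j') = dist i i' + dist j j'

  manhattan-walk : ∀ X Y → Walk (GridAdj n m) X Y (manhattan X Y)
  manhattan-walk (i , j) (i' , j') =
    mapʷ (_, j) (λ a → inj₂ (refl , a)) (line-walk i i') ++ʷ mapʷ (i' ,_) (λ a → inj₁ (refl , a)) (line-walk j j')

  manhattan-lipschitz : ∀ Y → Lipschitz (GridAdj n m) (λ X → manhattan X Y)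
  manhattan-lipschitz (y₁ , y₂) {i , _} (inj₁ (refl , a)) =
    ≤-trans (+-monoʳ-≤ (dist i y₁) (line-lipschitz (toℕ y₂) a)) (≤-reflexive (+-suc _ _))
  manhattan-lipschitz (y₁ , y₂) {_ , j} (inj₂ (refl , a)) = +-monoˡ-≤ (dist j y₂) (line-lipschitz (toℕ y₁) a)

  manhattan-self : ∀ X → manhattan X X ≡ 0
  manhattan-self (i , j) = cong₂ _+_ (∣n-n∣≡0 (toℕ i)) (∣n-n∣≡0 (toℕ j))

  manhattan-sym : ∀ X Y → manhattan X Y ≡ manhattan Y X
  manhattan-sym (i , j) (i' , j') = cong₂ _+_ (∣-∣-comm (toℕ i) (toℕ i')) (∣-∣-comm (toℕ j) (toℕ j'))

  manhattan-pos : ∀ {X Y} → X ≢ Y → 0 < manhattan X Y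
  manhattan-pos {i , j} {i' , j'} X≢Y with manhattan (i , j) (i' , j') in eq
  ... | suc _ = s≤s z≤n
  ... | zero = contradiction (cong₂ _,_ (same-coordinate (m+n≡0⇒m≡0 _ eq)) (same-coordinate (m+n≡0⇒n≡0 _ eq))) X≢Y
    where
    same-coordinate : ∀ {k} {a b : Fin k} → dist a b ≡ 0 → a ≡ b
    same-coordinate = toℕ-injective ∘ ∣m-n∣≡0⇒m≡n

∣-∣-split-≤ : ∀ {x y z} → x ≤ y → y ≤ z → ∣ x - z ∣ ≡ ∣ x - y ∣ + ∣ y - z ∣
∣-∣-split-≤ {y = y} z≤n y≤z = sym (trans (cong (y +_) (m≤n⇒∣m-n∣≡n∸m y≤z)) (m+[n∸m]≡n y≤z))
∣-∣-split-≤ (s≤s x≤y) (s≤s y≤z) = ∣-∣-split-≤ x≤y y≤z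

∣-∣-split-≥ : ∀ {x y z} → z ≤ y → y ≤ x → ∣ x - z ∣ ≡ ∣ x - y ∣ + ∣ y - z ∣
∣-∣-split-≥ {x} {y} {z} z≤y y≤x = begin
  ∣ x - z ∣               ≡⟨ ∣-∣-comm x z ⟩
  ∣ z - x ∣               ≡⟨ ∣-∣-split-≤ z≤y y≤x ⟩
  ∣ z - y ∣ + ∣ y - x ∣   ≡⟨ +-comm ∣ z - y ∣ ∣ y - x ∣ ⟩
  ∣ y - x ∣ + ∣ z - y ∣   ≡⟨ cong₂ _+_ (∣-∣-comm y x) (∣-∣-comm z y) ⟩
  ∣ x - y ∣ + ∣ y - z ∣   ∎
  where open ≡-Reasoning

data End : Set where
  lo hi : End

opp : End → End
opp lo = hi
opp hi = lo

end : ∀ {L} → End → Fin (suc L)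
end lo = F.zero
end {L} hi = fromℕ L

≤-end : ∀ {L} (x : Fin (suc L)) → toℕ x ≤ toℕ (end {L} hi)
≤-end {L} x = subst (toℕ x ≤_) (sym (toℕ-fromℕ L)) (toℕ≤pred[n] x)

ends-antipodal : ∀ {L} s (x : Fin (suc L)) → dist x (end s) + dist x (end (opp s)) ≡ L
ends-antipodal {L} lo x = begin
  ∣ toℕ x - 0 ∣ + dist x (end hi)  ≡⟨ cong (_+ dist x (end hi)) (∣-∣-identityʳ (toℕ x)) ⟩
  toℕ x + dist x (end hi)          ≡⟨ ∣-∣-split-≤ z≤n (≤-end x) ⟨
  toℕ (fromℕ L)                    ≡⟨ toℕ-fromℕ L ⟩
  L                                ∎
  where open ≡-Reasoning
ends-antipodal {L} hi x = trans (+-comm (dist x (end hi)) (dist x (end lo))) (ends-antipodal lo x)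

Beyond : ∀ {L} → Fin (suc L) → Fin (suc L) → End → Set
Beyond a b s = dist a (end s) ≡ dist a b + dist b (end s)

far-end : ∀ {L} (a b : Fin (suc L)) → ∃[ s ] (Beyond a b s × Beyond b a (opp s))
far-end a b with ≤-total (toℕ b) (toℕ a)
... | inj₁ b≤a = lo , ∣-∣-split-≥ z≤n b≤a , ∣-∣-split-≤ b≤a (≤-end a)
... | inj₂ a≤b = hi , ∣-∣-split-≤ a≤b (≤-end b) , ∣-∣-split-≥ z≤n a≤b

corner : ∀ {n' m'} → End → End → Vtx (suc n') (suc m')
corner s t = end s , end t

corner-∈ : ∀ {n' m'} s t → corner s t ∈ corners n' m'
corner-∈ lo lo = here refl
corner-∈ hi lo = there (here refl)
corner-∈ hi hi = there (there (here refl))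
corner-∈ lo hi = there (there (there (here refl)))

module _ {n' m' : ℕ} where

  manhattan-beyond : ∀ (A B : Vtx (suc n') (suc m')) s t →
    Beyond (proj₁ A) (proj₁ B) s → Beyond (proj₂ A) (proj₂ B) t →
    manhattan A (corner s t) ≡ manhattan A B + manhattan B (corner s t)
  manhattan-beyond (a₁ , a₂) (b₁ , b₂) s t h₁ h₂ =
    trans (cong₂ _+_ h₁ h₂) (interchange (dist a₁ b₁) (dist b₁ (end s)) (dist a₂ b₂) (dist b₂ (end t)))

  corners-antipodal : ∀ s t (X : Vtx (suc n') (suc m')) →
    manhattan X (corner s t) + manhattan X (corner (opp s) (opp t)) ≡ n' + m'
  corners-antipodal s t (x₁ , x₂) =
    trans (interchange (dist x₁ (end s)) (dist x₂ (end t)) (dist x₁ (end (opp s))) (dist x₂ (end (opp t))))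
          (cong₂ _+_ (ends-antipodal s x₁) (ends-antipodal t x₂))

  module _ (E F : Vtx (suc n') (suc m')) where

    open AddedEdge manhattan manhattan-walk manhattan-lipschitz manhattan-self E F

    corners-resolve : Resolving G⁺ (corners n' m')
    corners-resolve A@(a₁ , a₂) B@(b₁ , b₂) A≢B
      with far-end a₁ b₁ | far-end a₂ b₂
    ... | s , A-B-c₁ , B-A-c'₁ | t , A-B-c₂ , B-A-c'₂
      with opposite-corners-resolve manhattan-sym {A} {B} {corner s t} {corner (opp s) (opp t)}
             (manhattan-pos A≢B)
             (manhattan-beyond A B s t A-B-c₁ A-B-c₂)
             (manhattan-beyond B A (opp s) (opp t) B-A-c'₁ B-A-c'₂)
             (corners-antipodal s t)
    ... | inj₁ ≢c = corner s t , corner-∈ s t , _ , _ , d⁺-isDist A _ , d⁺-isDist B _ , ≢c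
    ... | inj₂ ≢c' = corner (opp s) (opp t) , corner-∈ (opp s) (opp t) , _ , _ , d⁺-isDist A _ , d⁺-isDist B _ , ≢c'

theorem2 : (n' m' : ℕ) → (E F : Vtx (suc n') (suc m')) →
    (∀ k → IsDist (GridAdj (suc n') (suc m')) E F k → 2 ≤ k) →
    Resolving (AddEdge (GridAdj (suc n') (suc m')) E F) (corners n' m')
      × MetricDimLe (AddEdge (GridAdj (suc n') (suc m')) E F) 4
theorem2 n' m' E F _ = corners-resolve E F , corners n' m' , ≤-refl , corners-resolve E F
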